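{- Let $e_1,\dots,e_m$ be a sequence of edges on a node set $V$ such that each $G_i=(V,\{e_1,\dots,e_i\})$ is acyclic, and for each $i$ let $T_{i-1}$ be a topological order of $G_{i-1}$. Then for every $i$: (i) $|\delta^{(i)}|\le \Delta\Phi_i+1$ and (ii) $|\delta^{(i)}|\le 2\Delta\Phi_i$.
   Context: $x\leadsto y$ means there is a directed path from $x$ to $y$ in the current graph (with $x\leadsto x$). A topological order is a bijection $T:V\to\{1,\dots,|V|\}$ with $T(x)<T(y)$ whenever $x\leadsto y$, $x\ne y$. For the $i$-th edge $e_i=u\to v$ and $T=T_{i-1}$, let $R_B^{(i)}=\{x\in V: T(v)\le T(x),\ x\leadsto u\}$, $R_F^{(i)}=\{y\in V: T(y)\le T(u),\ v\leadsto y\}$ and $\delta^{(i)}=R_F^{(i)}\cup R_B^{(i)}$, with $|\delta^{(i)}|$ its number of nodes. A comparable pair is a pair of distinct nodes $x,y$ with $x\leadsto y$ or $y\leadsto x$; $\Phi_i$ is the number of comparable pairs in $G_i$ ($\Phi_0=0$) and $\Delta\Phi_i=\Phi_i-\Phi_{i-1}$. -}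

module Defs where

open import Data.Nat using (ℕ; zero; suc)
open import Data.Fin using (Fin; toℕ; _≤_; _<_)
open import Data.Product using (_×_; _,_; Σ; ∃)
open import Data.Sum using (_⊎_)
open import Data.List using (List; length; take; lookup)
open import Data.List.Membership.Propositional using (_∈_)
open import Data.List.Relation.Unary.Unique.Propositional using (Unique)
open import Relation.Binary.PropositionalEquality using (_≡_)
open import Relation.Nullary using (¬_)
open import Function.Definitions using (Bijective)

Edges : ℕ → Set
Edges n = List (Fin n × Fin n)

data Reach {n : ℕ} (E : Edges n) : Fin n → Fin n → Set where
  here : ∀ {x} → Reach E x x
  step : ∀ {x z y} → (x , z) ∈ E → Reach E z y → Reach E x y

Acyclic : ∀ {n} → Edges n → Set
Acyclic {n} E = ∀ (x z : Fin n) → (x , z) ∈ E → ¬ Reach E z x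

-- Topological order: a bijection T : V → {0,…,|V|-1} (shift of {1,…,|V|})
-- with T x < T y whenever x ⇝ y and x ≠ y.
TopOrder : ∀ {n} → Edges n → (Fin n → Fin n) → Set
TopOrder {n} E T =
  Bijective _≡_ _≡_ T × (∀ (x y : Fin n) → Reach E x y → ¬ (x ≡ y) → T x < T y)

HasCard : {A : Set} → (A → Set) → ℕ → Set
HasCard {A} P k =
  Σ (List A) λ l → Unique l × (∀ a → (a ∈ l → P a) × (P a → a ∈ l)) × length l ≡ k

G : ∀ {n} → Edges n → ℕ → Edges n
G es j = take j es

-- Comparable pairs counted as ordered pairs (x , y), x ≠ y, x ⇝ y.
-- In an acyclic graph each unordered comparable pair {x,y} yields exactly one such ordered pair.
ComparableOrd : ∀ {n} → Edges n → Fin n × Fin n → Set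
ComparableOrd E (x , y) = ¬ (x ≡ y) × Reach E x y

RB : ∀ {n} → Edges n → (Fin n → Fin n) → Fin n → Fin n → Fin n → Set
RB E T u v x = (T v ≤ T x) × Reach E x u

RF : ∀ {n} → Edges n → (Fin n → Fin n) → Fin n → Fin n → Fin n → Set
RF E T u v y = (T y ≤ T u) × Reach E v y

δ : ∀ {n} → Edges n → (Fin n → Fin n) → Fin n → Fin n → Fin n → Set
δ E T u v x = RF E T u v x ⊎ RB E T u v x

-- If δ is empty the claim reduces to Φ_{i-1} ≤ Φ_i. Otherwise T(v) ≤ T(u), and every pair (x, y)
-- with x ⇝ u, v ⇝ y in G_{i-1} and T(y) ≤ T(x) is comparable in G_i (through the new edge) but not
-- in G_{i-1} (T would have to increase from x to y). Split δ into a part F ⊆ R_F and a part B ⊆ R_B: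
-- the pairs (u, v), (u, y) for y ∈ F ∖ {v} and (x, v) for x ∈ B ∖ {u} are distinct and all of this
-- kind, so ΔΦ ≥ 1 + (|F| − 1) + (|B| − 1) ≥ |δ| − 1, which is (i); (ii) follows from (i) and ΔΦ ≥ 1.
module Submission where

open import Defs
open import Data.Nat using (ℕ; suc; _+_; _*_; _≤_; z≤n; s≤s; z<s)
open import Data.Nat.Properties
  using ( ≤-refl; ≤-trans; <⇒≤; <⇒≱; +-comm; +-assoc; +-suc; +-identityʳ
        ; +-mono-≤; +-monoˡ-≤; +-monoʳ-≤; *-monoʳ-≤; m≤m+n; m<m+n; module ≤-Reasoning)
open import Data.Fin using (Fin; toℕ; _≟_) renaming (_≤_ to _≤ᶠ_; _<_ to _<ᶠ_)
open import Data.Fin.Properties using (toℕ<n)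
open import Data.Product using (_×_; _,_; proj₁; proj₂; ∃)
open import Data.Sum using (_⊎_; inj₁; inj₂)
open import Data.Empty using (⊥-elim)
open import Data.List using (List; []; _∷_; _++_; length; lookup; map; filter)
open import Data.List.Properties using (take-suc; length-++; length-map; length-removeAt′)
open import Data.List.Membership.Propositional using (_∈_; _─_)
open import Data.List.Membership.Propositional.Properties
  using (∈-map⁻; ∈-++⁻; ∈-++⁺ʳ; ∈-filter⁺; ∈-filter⁻)
open import Data.List.Relation.Unary.Any using (here; there; index)
import Data.List.Relation.Unary.All as All
open import Data.List.Relation.Unary.All.Properties using (anti-mono)
open import Data.List.Relation.Unary.Unique.Propositional using (Unique; []; _∷_)
import Data.List.Relation.Unary.Unique.Propositional.Properties as Unique
open import Data.List.Relation.Binary.Subset.Propositional using (_⊆_)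
open import Data.List.Relation.Binary.Subset.Propositional.Properties using (⊆-reflexive; xs⊆xs++ys)
open import Relation.Binary.Definitions using (DecidableEquality)
open import Relation.Binary.PropositionalEquality using (_≡_; _≢_; refl; sym; trans; cong; cong₂)
open import Relation.Nullary using (¬_; ¬?; Dec; yes; no)
open import Function using (_∘_)

module _ {A : Set} where

  ∈-─⁺ : ∀ {x y : A} {ys} (x∈ys : x ∈ ys) → y ∈ ys → y ≢ x → y ∈ ys ─ x∈ys
  ∈-─⁺ (here refl) (here refl)  y≢x = ⊥-elim (y≢x refl)
  ∈-─⁺ (here refl) (there y∈ys) _   = y∈ys
  ∈-─⁺ (there _)   (here refl)  _   = here refl
  ∈-─⁺ (there x∈ys) (there y∈ys) y≢x = there (∈-─⁺ x∈ys y∈ys y≢x)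

  Unique-⊆⇒length≤ : ∀ {xs ys : List A} → Unique xs → xs ⊆ ys → length xs ≤ length ys
  Unique-⊆⇒length≤ {[]}     _              _     = z≤n
  Unique-⊆⇒length≤ {x ∷ xs} {ys} (x∉xs ∷ xs!) xs⊆ys = begin
    suc (length xs)          ≤⟨ s≤s (Unique-⊆⇒length≤ xs! xs⊆ys─x) ⟩
    suc (length (ys ─ x∈ys)) ≡⟨ sym (length-removeAt′ ys (index x∈ys)) ⟩
    length ys                ∎
    where
    open ≤-Reasoning
    x∈ys : x ∈ ys
    x∈ys = xs⊆ys (here refl)
    xs⊆ys─x : xs ⊆ ys ─ x∈ys
    xs⊆ys─x y∈xs = ∈-─⁺ x∈ys (xs⊆ys (there y∈xs)) (λ y≡x → All.lookup x∉xs y∈xs (sym y≡x))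

  record Split (P Q : A → Set) (xs : List A) : Set where
    field
      left right   : List A
      left-unique  : Unique left
      right-unique : Unique right
      left⊆P       : ∀ {a} → a ∈ left → P a
      right⊆Q      : ∀ {a} → a ∈ right → Q a
      left⊆xs      : left ⊆ xs
      right⊆xs     : right ⊆ xs
      length-split : length left + length right ≡ length xs

  split : ∀ {P Q : A → Set} {xs} → Unique xs → (∀ {a} → a ∈ xs → P a ⊎ Q a) → Split P Q xs
  split {xs = []} _ _ = record
    { left = [] ; right = [] ; left-unique = [] ; right-unique = []
    ; left⊆P = λ () ; right⊆Q = λ () ; left⊆xs = λ () ; right⊆xs = λ () ; length-split = refl }
  split {P = P} {Q} {x ∷ xs} (x∉xs ∷ xs!) cover with cover (here refl) | split {P = P} {Q} xs! (cover ∘ there)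
  ... | inj₁ px | s = record
    { left = x ∷ left ; right = right
    ; left-unique = anti-mono left⊆xs x∉xs ∷ left-unique ; right-unique = right-unique
    ; left⊆P = λ { (here refl) → px ; (there a∈) → left⊆P a∈ } ; right⊆Q = right⊆Q
    ; left⊆xs = λ { (here refl) → here refl ; (there a∈) → there (left⊆xs a∈) }
    ; right⊆xs = there ∘ right⊆xs
    ; length-split = cong suc length-split }
    where open Split s
  ... | inj₂ qx | s = record
    { left = left ; right = x ∷ right
    ; left-unique = left-unique ; right-unique = anti-mono right⊆xs x∉xs ∷ right-unique
    ; left⊆P = left⊆P ; right⊆Q = λ { (here refl) → qx ; (there a∈) → right⊆Q a∈ }
    ; left⊆xs = there ∘ left⊆xs
    ; right⊆xs = λ { (here refl) → here refl ; (there a∈) → there (right⊆xs a∈) }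
    ; length-split = trans (+-suc (length left) (length right)) (cong suc length-split) }
    where open Split s

module Spokes {A : Set} (_≟ᴬ_ : DecidableEquality A) where

  ≢? : (c a : A) → Dec (a ≢ c)
  ≢? c a = ¬? (a ≟ᴬ c)

  _∖_ : List A → A → List A
  xs ∖ c = filter (≢? c) xs

  ∖-unique : ∀ {xs} c → Unique xs → Unique (xs ∖ c)
  ∖-unique c = Unique.filter⁺ (≢? c)

  length≤suc-∖ : ∀ {xs} c → Unique xs → length xs ≤ suc (length (xs ∖ c))
  length≤suc-∖ {xs} c xs! = Unique-⊆⇒length≤ xs! xs⊆c∷xs∖c
    where
    xs⊆c∷xs∖c : xs ⊆ c ∷ xs ∖ c
    xs⊆c∷xs∖c {a} a∈xs with a ≟ᴬ c
    ... | yes refl = here refl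
    ... | no a≢c   = there (∈-filter⁺ (≢? c) a∈xs a≢c)

  spokes : A → A → List A → List A → List (A × A)
  spokes u v F B = map (u ,_) (F ∖ v) ++ map (_, v) (B ∖ u)

  ∈-spokes⁻ : ∀ u v F B {a} → a ∈ spokes u v F B →
    (∃ λ y → y ∈ F × y ≢ v × a ≡ (u , y)) ⊎ (∃ λ x → x ∈ B × x ≢ u × a ≡ (x , v))
  ∈-spokes⁻ u v F B a∈ with ∈-++⁻ (map (u ,_) (F ∖ v)) a∈
  ... | inj₁ a∈F with ∈-map⁻ (u ,_) a∈F
  ...   | y , y∈F∖v , a≡uy = let y∈F , y≢v = ∈-filter⁻ (≢? v) {xs = F} y∈F∖v in inj₁ (y , y∈F , y≢v , a≡uy)
  ∈-spokes⁻ u v F B a∈ | inj₂ a∈B with ∈-map⁻ (_, v) a∈B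
  ...   | x , x∈B∖u , a≡xv = let x∈B , x≢u = ∈-filter⁻ (≢? u) {xs = B} x∈B∖u in inj₂ (x , x∈B , x≢u , a≡xv)

  hub∷spokes-unique : ∀ u v {F B} → Unique F → Unique B → Unique ((u , v) ∷ spokes u v F B)
  hub∷spokes-unique u v {F} {B} F! B! = All.tabulate hub∉spokes ∷ spokes-unique
    where
    hub∉spokes : ∀ {a} → a ∈ spokes u v F B → (u , v) ≢ a
    hub∉spokes a∈ uv≡a with ∈-spokes⁻ u v F B a∈
    ... | inj₁ (y , _ , y≢v , refl) = y≢v (sym (cong proj₂ uv≡a))
    ... | inj₂ (x , _ , x≢u , refl) = x≢u (sym (cong proj₁ uv≡a))
    disjoint : ∀ {a} → ¬ (a ∈ map (u ,_) (F ∖ v) × a ∈ map (_, v) (B ∖ u))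
    disjoint (a∈F , a∈B) with ∈-map⁻ (u ,_) a∈F | ∈-map⁻ (_, v) a∈B
    ... | y , y∈F∖v , refl | _ , _ , uy≡xv = proj₂ (∈-filter⁻ (≢? v) {xs = F} y∈F∖v) (cong proj₂ uy≡xv)
    spokes-unique : Unique (spokes u v F B)
    spokes-unique = Unique.++⁺ (Unique.map⁺ (cong proj₂) (∖-unique v F!))
                               (Unique.map⁺ (cong proj₁) (∖-unique u B!)) disjoint

  length-spokes : ∀ u v F B → length (spokes u v F B) ≡ length (F ∖ v) + length (B ∖ u)
  length-spokes u v F B = trans (length-++ (map (u ,_) (F ∖ v)))
    (cong₂ _+_ (length-map (u ,_) (F ∖ v)) (length-map (_, v) (B ∖ u)))

insertion-bounds : ∀ {d p c k} → d ≤ suc (suc k) → p + suc k ≤ c →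
  (d + p ≤ c + 1) × (d + 2 * p ≤ 2 * c)
insertion-bounds {d} {p} {c} {k} d≤2+k gain = d+p≤c+1 , d+2p≤2c
  where
  open ≤-Reasoning
  d+p≤c+1 : d + p ≤ c + 1
  d+p≤c+1 = begin
    d + p             ≤⟨ +-monoˡ-≤ p d≤2+k ⟩
    suc (suc k) + p   ≡⟨ +-comm (suc (suc k)) p ⟩
    p + suc (suc k)   ≡⟨ +-suc p (suc k) ⟩
    suc (p + suc k)   ≤⟨ s≤s gain ⟩
    suc c             ≡⟨ +-comm 1 c ⟩
    c + 1             ∎
  d+2p≤2c : d + 2 * p ≤ 2 * c
  d+2p≤2c = begin
    d + 2 * p         ≡⟨ cong (λ x → d + (p + x)) (+-identityʳ p) ⟩
    d + (p + p)       ≡⟨ sym (+-assoc d p p) ⟩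
    (d + p) + p       ≤⟨ +-monoˡ-≤ p d+p≤c+1 ⟩
    (c + 1) + p       ≡⟨ +-assoc c 1 p ⟩
    c + suc p         ≤⟨ +-monoʳ-≤ c (≤-trans (m<m+n p z<s) gain) ⟩
    c + c             ≡⟨ cong (c +_) (sym (+-identityʳ c)) ⟩
    2 * c             ∎

module _ {n : ℕ} where

  Reach-trans : ∀ {E : Edges n} {x y z} → Reach E x y → Reach E y z → Reach E x z
  Reach-trans here           y⇝z = y⇝z
  Reach-trans (step e x⇝y) y⇝z = step e (Reach-trans x⇝y y⇝z)

  Reach-mono : ∀ {E E' : Edges n} → E ⊆ E' → ∀ {x y} → Reach E x y → Reach E' x y
  Reach-mono E⊆E' here         = here
  Reach-mono E⊆E' (step e x⇝y) = step (E⊆E' e) (Reach-mono E⊆E' x⇝y)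

module Insertion {n : ℕ} {E E' : Edges n} {u v : Fin n} (T : Fin n → Fin n)
  (E⊆E' : E ⊆ E') (uv∈E' : (u , v) ∈ E') (acyclic : Acyclic E')
  (T-increasing : ∀ x y → Reach E x y → x ≢ y → T x <ᶠ T y) where

  open Spokes (_≟_ {n})

  Reach⇒T≤ : ∀ {x y} → Reach E x y → T x ≤ᶠ T y
  Reach⇒T≤ {x} {y} x⇝y with x ≟ y
  ... | yes refl = ≤-refl
  ... | no x≢y   = <⇒≤ (T-increasing x y x⇝y x≢y)

  δ⇒Tv≤Tu : ∀ {w} → δ E T u v w → T v ≤ᶠ T u
  δ⇒Tv≤Tu (inj₁ (Tw≤Tu , v⇝w)) = ≤-trans (Reach⇒T≤ v⇝w) Tw≤Tu
  δ⇒Tv≤Tu (inj₂ (Tv≤Tw , w⇝u)) = ≤-trans Tv≤Tw (Reach⇒T≤ w⇝u)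

  comparable-mono : ∀ {a} → ComparableOrd E a → ComparableOrd E' a
  comparable-mono (x≢y , x⇝y) = x≢y , Reach-mono E⊆E' x⇝y

  NewPair : Fin n × Fin n → Set
  NewPair a = ComparableOrd E' a × ¬ ComparableOrd E a

  bridge-new : ∀ {x y} → Reach E x u → Reach E v y → T y ≤ᶠ T x → NewPair (x , y)
  bridge-new {x} {y} x⇝u v⇝y Ty≤Tx = (x≢y , x⇝'y) , old-incomparable
    where
    x⇝'y : Reach E' x y
    x⇝'y = Reach-trans (Reach-mono E⊆E' x⇝u) (step uv∈E' (Reach-mono E⊆E' v⇝y))
    x≢y : x ≢ y
    x≢y refl = acyclic u v uv∈E' (Reach-mono E⊆E' (Reach-trans v⇝y x⇝u))
    old-incomparable : ¬ ComparableOrd E (x , y)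
    old-incomparable (x≢y , x⇝y) = <⇒≱ (T-increasing x y x⇝y x≢y) Ty≤Tx

  hub∷spokes-new : ∀ {F B} → (∀ {y} → y ∈ F → RF E T u v y) → (∀ {x} → x ∈ B → RB E T u v x) →
    T v ≤ᶠ T u → ∀ {a} → a ∈ (u , v) ∷ spokes u v F B → NewPair a
  hub∷spokes-new F⊆RF B⊆RB Tv≤Tu (here refl) = bridge-new here here Tv≤Tu
  hub∷spokes-new {F} {B} F⊆RF B⊆RB Tv≤Tu (there a∈) with ∈-spokes⁻ u v F B a∈
  ... | inj₁ (y , y∈F , _ , refl) = let (Ty≤Tu , v⇝y) = F⊆RF y∈F in bridge-new here v⇝y Ty≤Tu
  ... | inj₂ (x , x∈B , _ , refl) = let (Tv≤Tx , x⇝u) = B⊆RB x∈B in bridge-new x⇝u here Tv≤Tx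

  module _ {old new : List (Fin n × Fin n)} (old! : Unique old)
    (old⊆E : ∀ {a} → a ∈ old → ComparableOrd E a) (E'⊆new : ∀ {a} → ComparableOrd E' a → a ∈ new) where

    old⊆new : old ⊆ new
    old⊆new = E'⊆new ∘ comparable-mono ∘ old⊆E

    comparable-gain : ∀ {F B} → Unique F → Unique B →
      (∀ {y} → y ∈ F → RF E T u v y) → (∀ {x} → x ∈ B → RB E T u v x) → T v ≤ᶠ T u →
      length old + suc (length (F ∖ v) + length (B ∖ u)) ≤ length new
    comparable-gain {F} {B} F! B! F⊆RF B⊆RB Tv≤Tu = begin
      length old + suc (length (F ∖ v) + length (B ∖ u))
        ≡⟨ cong (λ m → length old + suc m) (sym (length-spokes u v F B)) ⟩
      length old + length hub∷spokes   ≡⟨ sym (length-++ old) ⟩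
      length (old ++ hub∷spokes)       ≤⟨ Unique-⊆⇒length≤ old++hub∷spokes-unique old++hub∷spokes⊆new ⟩
      length new                       ∎
      where
      open ≤-Reasoning
      hub∷spokes : List (Fin n × Fin n)
      hub∷spokes = (u , v) ∷ spokes u v F B
      new-pairs : ∀ {a} → a ∈ hub∷spokes → NewPair a
      new-pairs = hub∷spokes-new F⊆RF B⊆RB Tv≤Tu
      old++hub∷spokes-unique : Unique (old ++ hub∷spokes)
      old++hub∷spokes-unique = Unique.++⁺ old! (hub∷spokes-unique u v F! B!)
        (λ (a∈old , a∈hub∷spokes) → proj₂ (new-pairs a∈hub∷spokes) (old⊆E a∈old))
      old++hub∷spokes⊆new : old ++ hub∷spokes ⊆ new
      old++hub∷spokes⊆new a∈ with ∈-++⁻ old a∈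
      ... | inj₁ a∈old        = old⊆new a∈old
      ... | inj₂ a∈hub∷spokes = E'⊆new (proj₁ (new-pairs a∈hub∷spokes))

  δ-bound : ∀ {d Φ Φ'} → HasCard (δ E T u v) d → HasCard (ComparableOrd E) Φ →
    HasCard (ComparableOrd E') Φ' → (d + Φ ≤ Φ' + 1) × (d + 2 * Φ ≤ 2 * Φ')
  δ-bound ([] , _ , _ , refl) (old , old! , old↔ , refl) (new , _ , new↔ , refl) =
    ≤-trans old≤new (m≤m+n _ 1) , *-monoʳ-≤ 2 old≤new
    where
    old≤new : length old ≤ length new
    old≤new = Unique-⊆⇒length≤ old! (old⊆new old! (proj₁ (old↔ _)) (proj₂ (new↔ _)))
  δ-bound (w ∷ ws , ds! , ds↔ , refl) (old , old! , old↔ , refl) (new , _ , new↔ , refl) =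
    insertion-bounds d≤2+k
      (comparable-gain old! (proj₁ (old↔ _)) (proj₂ (new↔ _)) left-unique right-unique left⊆P right⊆Q
        (δ⇒Tv≤Tu (proj₁ (ds↔ w) (here refl))))
    where
    open ≤-Reasoning
    open Split (split ds! (proj₁ (ds↔ _)))
    d≤2+k : length (w ∷ ws) ≤ suc (suc (length (left ∖ v) + length (right ∖ u)))
    d≤2+k = begin
      length (w ∷ ws)                                    ≡⟨ sym length-split ⟩
      length left + length right                         ≤⟨ +-mono-≤ (length≤suc-∖ v left-unique)
                                                                     (length≤suc-∖ u right-unique) ⟩
      suc (length (left ∖ v)) + suc (length (right ∖ u)) ≡⟨ cong suc (+-suc _ _) ⟩
      suc (suc (length (left ∖ v) + length (right ∖ u))) ∎

theorem3 : ∀ (n : ℕ) (es : Edges n)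
    → (∀ (j : ℕ) → j ≤ length es → Acyclic (G es j))
    → ∀ (i : Fin (length es)) (T : Fin n → Fin n)
    → TopOrder (G es (toℕ i)) T
    → ∀ (d Φprev Φcur : ℕ)
    → HasCard (δ (G es (toℕ i)) T (proj₁ (lookup es i)) (proj₂ (lookup es i))) d
    → HasCard (ComparableOrd (G es (toℕ i))) Φprev
    → HasCard (ComparableOrd (G es (suc (toℕ i)))) Φcur
    → (d + Φprev ≤ Φcur + 1) × (d + 2 * Φprev ≤ 2 * Φcur)
theorem3 n es acyclic i T (_ , T-increasing) _ _ _ =
  Insertion.δ-bound T Gᵢ⊆Gᵢ₊₁ eᵢ∈Gᵢ₊₁ (acyclic (suc (toℕ i)) (toℕ<n i)) T-increasing
  where
  Gᵢ₊₁≡Gᵢ∷ʳeᵢ : G es (suc (toℕ i)) ≡ G es (toℕ i) ++ lookup es i ∷ []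
  Gᵢ₊₁≡Gᵢ∷ʳeᵢ = take-suc es i
  Gᵢ⊆Gᵢ₊₁ : G es (toℕ i) ⊆ G es (suc (toℕ i))
  Gᵢ⊆Gᵢ₊₁ = ⊆-reflexive (sym Gᵢ₊₁≡Gᵢ∷ʳeᵢ) ∘ xs⊆xs++ys _ _
  eᵢ∈Gᵢ₊₁ : lookup es i ∈ G es (suc (toℕ i))
  eᵢ∈Gᵢ₊₁ = ⊆-reflexive (sym Gᵢ₊₁≡Gᵢ∷ʳeᵢ) (∈-++⁺ʳ (G es (toℕ i)) (here refl))
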